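{- Let $p$ be a prime and let $(\Omega,S)$ be a coherent configuration with fibers $\Omega_1,\dots,\Omega_m$ such that $(\Omega_i,S_i)\simeq C_p\wr C_p$ for each $i$ and $n_s=p$ for each $s\in\bigcup_{i\ne j}S_{ij}$. Let $R$ be the set of regular elements of $S$ and $N:=\bigcup_{i=1}^mS_i\cup(S\setminus R)$. Then either $R=S$ or $N=S$.
   Context: A coherent configuration is a pair $(\Omega,S)$ of a finite set $\Omega$ and a partition $S$ of $\Omega\times\Omega$ such that $1_\Omega$ is a union of elements of $S$, $s^\ast:=\{(\beta,\alpha)\mid(\alpha,\beta)\in s\}\in S$ for $s\in S$, and $\sigma_s\sigma_t=\sum_{u\in S}c_{st}^u\sigma_u$ with nonnegative integers $c_{st}^u$, where $\sigma_u$ is the adjacency matrix of $u$. Fibers are the sets $\Delta$ with $1_\Delta\in S$; they partition $\Omega$. $S_{ij}:=\{s\in S\mid s\subseteq\Omega_i\times\Omega_j\}$, $S_i:=S_{ii}$. For $s\in S_{ij}$, $n_s:=|\{\beta\mid(\alpha,\beta)\in s\}|$ for any $\alpha\in\Omega_i$. The complex product of $T,U\subseteq S$ is $TU:=\{s\mid c_{tu}^s>0$ for some $t\in T,u\in U\}$, singletons written without braces. An element $s\in S$ is regular if $ss^\ast s=\{s\}$. $C_p\wr C_p$ is the association scheme on $\mathbb{Z}_p\times\mathbb{Z}_p$ with relations $\{((x,y),(x+a,y))\}$ ($a\in\mathbb{Z}_p$) and $\{((x_1,y),(x_2,y+b))\}$ ($b\ne0$). -}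

module Defs where

open import Data.Nat using (ℕ; zero; suc; _+_; _∸_; _<_)
open import Data.Nat.Divisibility using (_∣_)
open import Data.Fin using (Fin; toℕ) renaming (zero to fzero; suc to fsuc)
open import Data.Fin.Properties using (_≟_)
open import Data.Bool using (Bool; true; false; _∧_)
open import Data.Product using (Σ; ∃; _×_; _,_)
open import Data.Sum using (_⊎_)
open import Relation.Nullary using (¬_)
open import Relation.Nullary.Decidable using (⌊_⌋)
open import Relation.Binary.PropositionalEquality using (_≡_)
open import Function.Bundles using (_⇔_)

count : ∀ {n} → (Fin n → Bool) → ℕ
count {zero} P = zero
count {suc n} P with P fzero
... | true  = suc (count (λ i → P (fsuc i)))
... | false = count (λ i → P (fsuc i))

-- A coherent configuration on Ω = Fin n whose relation set S = Fin r.
-- The partition S of Ω × Ω is given by the colouring col : (α,β) ↦ the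
-- element of S containing (α,β); surjectivity says every class is nonempty.
record CoherentConfiguration (n r : ℕ) : Set where
  field
    col : Fin n → Fin n → Fin r
    surj : ∀ (s : Fin r) → ∃ λ α → ∃ λ β → col α β ≡ s
    -- 1_Ω is a union of elements of S
    diagonal : ∀ α β γ → col α α ≡ col β γ → β ≡ γ
    -- s* ∈ S for s ∈ S
    converse : ∀ α β α' β' → col α β ≡ col α' β' → col β α ≡ col β' α'

  paths : Fin r → Fin r → Fin n → Fin n → ℕ
  paths s t α β = count (λ γ → ⌊ col α γ ≟ s ⌋ ∧ ⌊ col γ β ≟ t ⌋)

  field
    -- σ_s σ_t = Σ_u c_{st}^u σ_u : path counts depend only on the relation of (α,β)
    coherent : ∀ s t α β α' β' → col α β ≡ col α' β' → paths s t α β ≡ paths s t α' β'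

  StructPos : Fin r → Fin r → Fin r → Set
  StructPos s t u = ∃ λ α → ∃ λ β → col α β ≡ u × 0 < paths s t α β

  Subset : Set₁
  Subset = Fin r → Set

  ｛_｝ : Fin r → Subset
  ｛ s ｝ = λ u → u ≡ s

  -- the singleton {s*}
  star : Fin r → Subset
  star s = λ t → ∀ α β → col α β ≡ s → col β α ≡ t

  _⊙_ : Subset → Subset → Subset
  (T ⊙ U) u = ∃ λ t → ∃ λ t' → T t × U t' × StructPos t t' u

  Regular : Fin r → Set
  Regular s = ∀ u → (((｛ s ｝ ⊙ star s) ⊙ ｛ s ｝) u ⇔ (u ≡ s))

  InFiber : Fin n → Fin n → Set
  InFiber α β = col β β ≡ col α α

  InSomeSi : Fin r → Set
  InSomeSi s = ∀ α β → col α β ≡ s → col α α ≡ col β β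

  ValencyOffDiag : ℕ → Set
  ValencyOffDiag p = ∀ α β → ¬ (col α α ≡ col β β) →
    count (λ γ → ⌊ col α γ ≟ col α β ⌋) ≡ p

ModEq : ℕ → ℕ → ℕ → Set
ModEq p a b = (p ∣ (a ∸ b)) × (p ∣ (b ∸ a))

-- Two pairs of points of ℤ_p × ℤ_p (coordinates (x,y)) lie in the same
-- relation of C_p ≀ C_p:  either both have y-difference 0 and equal
-- x-difference a, or both have the same nonzero y-difference b.
WreathSame : (p : ℕ) → (Fin p × Fin p) → (Fin p × Fin p) → (Fin p × Fin p) → (Fin p × Fin p) → Set
WreathSame p (x₁ , y₁) (x₂ , y₂) (x₁' , y₁') (x₂' , y₂') =
  (y₁ ≡ y₂ × y₁' ≡ y₂' × ModEq p (toℕ x₂ + toℕ x₁') (toℕ x₂' + toℕ x₁))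
  ⊎ (¬ (y₁ ≡ y₂) × ModEq p (toℕ y₂ + toℕ y₁') (toℕ y₂' + toℕ y₁))

-- (Ω_i, S_i) ≃ C_p ≀ C_p for the fiber Ω_i containing α: a bijection
-- g : ℤ_p × ℤ_p → Ω_i carrying the relations of C_p ≀ C_p exactly onto
-- those of S_i.
FiberIsWreath : ∀ {n r} → CoherentConfiguration n r → ℕ → Fin n → Set
FiberIsWreath {n} C p α =
  Σ (Fin p × Fin p → Fin n) λ g →
    (∀ x y → g x ≡ g y → x ≡ y)
    × (∀ x → InFiber α (g x))
    × (∀ β → InFiber α β → ∃ λ x → g x ≡ β)
    × (∀ x y x' y' → (col (g x) (g y) ≡ col (g x') (g y')) ⇔ WreathSame p x y x' y')
  where open CoherentConfiguration C

-- Within a fiber, the thin relations of C_p ≀ C_p cut it into p blocks of p points. Let s be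
-- an off-diagonal relation, of valency p. If two s-neighbours of a point share a block, the
-- thin relation between them is a nonzero translation of that block which preserves
-- s-neighbourhoods; p being prime, every s-neighbourhood is then a whole block, and s is
-- regular (difunctional). Otherwise every s-neighbourhood meets each block exactly once.
-- Regularity thus depends only on the pair of fibers and is preserved by composition. A
-- triangle of fibers a, b, c with only ab regular is impossible: b and one point of each block
-- of a's fiber each have a neighbour of the relevant kind in a block missing c, and two of
-- these p + 1 points cannot share one. So one regular off-diagonal relation makes all of
-- them regular, and relations inside a fiber always are.

module Submission where

open import Defs
open import Data.Nat using (ℕ; zero; suc; _+_; _*_; _∸_; _<_; _≤_; NonZero; >-nonZero; >-nonZero⁻¹)
open import Data.Nat.Properties using (n≮n; ≤-total; +-comm; +-assoc; m+[n∸m]≡n; n∸n≡0; <-cmp; m<n⇒0<n∸m; ≤-<-trans; m∸n≤m; <⇒≤; *-distribˡ-+; +-identityʳ; n<1+n; ≤-reflexive)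
open import Data.Nat.DivMod using (_%_; _/_; %-congˡ; %-distribˡ-+; [m+kn]%n≡m%n; m≡m%n+[m/n]*n; m%n≤n; m<n⇒m%n≡m)
open import Data.Nat.Divisibility using (_∣_; >⇒∤; _∣0; m%n≡0⇒n∣m; divides)
open import Data.Nat.Primality using (Prime; euclidsLemma; ¬prime[0]; ¬prime[1])
open import Data.Nat.Tactic.RingSolver using (solve-∀)
open import Data.Bool using (Bool; true; false; T)
open import Data.Bool.Properties using (T-∧)
import Data.Fin as Fin
open import Data.Fin using (Fin; toℕ; inject≤; punchOut) renaming (zero to fzero; suc to fsuc)
open import Data.Fin.Properties using (_≟_; injective⇒≤; suc-injective; inject≤-injective; any?; all?; pigeonhole; <⇒≢; ¬∀⟶∃¬; punchOut-injective; toℕ-injective; toℕ<n)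
open import Data.Product using (Σ; ∃; ∃₂; _×_; _,_; proj₁; proj₂)
open import Data.Sum using (_⊎_; inj₁; inj₂)
open import Data.Empty using (⊥; ⊥-elim)
open import Function using (_∘_)
open import Function.Definitions using (Injective)
open import Relation.Binary.PropositionalEquality
open import Relation.Binary.Definitions using (tri<; tri≈; tri>)
open import Relation.Nullary using (¬_; yes; no; Dec)
open import Relation.Nullary.Decidable using (⌊_⌋; toWitness; fromWitness; decidable-stable; map′; _→-dec_; _×-dec_)
open import Function.Bundles using (Equivalence; mk⇔)

record Enumeration {n} (P : Fin n → Bool) (c : ℕ) : Set where
  field
    point     : Fin c → Fin n
    injective : Injective _≡_ _≡_ point
    sound     : ∀ i → T (P (point i))
    complete  : ∀ {j} → T (P j) → ∃ λ i → point i ≡ j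

-- Opaque: unfolding these proofs during unification makes the development far too slow.
opaque
  enumerate : ∀ {n} (P : Fin n → Bool) → Enumeration P (count P)
  enumerate {zero}  P = record
    { point = λ () ; injective = λ { {()} } ; sound = λ () ; complete = λ { {()} } }
  enumerate {suc n} P with P fzero in P0 | enumerate (P ∘ fsuc)
  ... | true | E = record
    { point = point′ ; injective = injective′ ; sound = sound′ ; complete = complete′ }
    where
    open Enumeration E
    point′ : Fin (suc (count (P ∘ fsuc))) → Fin (suc n)
    point′ fzero    = fzero
    point′ (fsuc i) = fsuc (point i)
    injective′ : Injective _≡_ _≡_ point′
    injective′ {fzero}  {fzero}  _  = refl
    injective′ {fsuc i} {fsuc j} eq = cong fsuc (injective (suc-injective eq))
    sound′ : ∀ i → T (P (point′ i))
    sound′ fzero    = subst T (sym P0) _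
    sound′ (fsuc i) = sound i
    complete′ : ∀ {j} → T (P j) → ∃ λ i → point′ i ≡ j
    complete′ {fzero}  _ = fzero , refl
    complete′ {fsuc j} t with i , eq ← complete t = fsuc i , cong fsuc eq
  ... | false | E = record
    { point = fsuc ∘ point ; injective = injective ∘ suc-injective ; sound = sound ; complete = complete′ }
    where
    open Enumeration E
    complete′ : ∀ {j} → T (P j) → ∃ λ i → fsuc (point i) ≡ j
    complete′ {fzero}  t = ⊥-elim (subst T P0 t)
    complete′ {fsuc j} t with i , eq ← complete t = i , cong fsuc eq

  injection⇒≤count : ∀ {n k} (P : Fin n → Bool) (f : Fin k → Fin n) → Injective _≡_ _≡_ f →
    (∀ i → T (P (f i))) → k ≤ count P
  injection⇒≤count {k = k} P f f-injective f-P = injective⇒≤ index-injective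
    where
    open Enumeration (enumerate P)
    index : Fin k → Fin (count P)
    index i = proj₁ (complete (f-P i))
    index-injective : Injective _≡_ _≡_ index
    index-injective {i} {j} eq = f-injective (begin
      f i               ≡⟨ proj₂ (complete (f-P i)) ⟨
      point (index i)   ≡⟨ cong point eq ⟩
      point (index j)   ≡⟨ proj₂ (complete (f-P j)) ⟩
      f j               ∎)
      where open ≡-Reasoning

  ≤count⇒injection : ∀ {n k} (P : Fin n → Bool) → k ≤ count P →
    Σ (Fin k → Fin n) λ f → Injective _≡_ _≡_ f × (∀ i → T (P (f i)))
  ≤count⇒injection P k≤c =
    point ∘ (λ i → inject≤ i k≤c) ,
    (λ eq → inject≤-injective k≤c k≤c _ _ (injective eq)) ,
    (λ i → sound (inject≤ i k≤c))
    where open Enumeration (enumerate P)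

  injective⇒surjective : ∀ {m} (f : Fin m → Fin m) → Injective _≡_ _≡_ f → ∀ y → ∃ λ x → f x ≡ y
  injective⇒surjective {suc m} f f-injective y with any? (λ x → f x ≟ y)
  ... | yes hit  = hit
  ... | no  miss = ⊥-elim (n≮n m (injective⇒≤ punchOut-injective′))
    where
    y≢f : ∀ x → y ≢ f x
    y≢f x eq = miss (x , sym eq)
    punchOut-injective′ : Injective _≡_ _≡_ (λ x → punchOut (y≢f x))
    punchOut-injective′ eq = f-injective (punchOut-injective (y≢f _) (y≢f _) eq)

ModEq-refl : ∀ p a → ModEq p a a
ModEq-refl p a = p∣a∸a , p∣a∸a
  where
  p∣a∸a : p ∣ a ∸ a
  p∣a∸a = subst (p ∣_) (sym (n∸n≡0 a)) (p ∣0)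

module _ {p : ℕ} .{{_ : NonZero p}} where

  ∣∸⇒%-≡ : ∀ {a b} → a ≤ b → p ∣ b ∸ a → b % p ≡ a % p
  ∣∸⇒%-≡ {a} {b} a≤b (divides k b∸a≡kp) = begin
    b % p               ≡⟨ %-congˡ (m+[n∸m]≡n a≤b) ⟨
    (a + (b ∸ a)) % p   ≡⟨ cong (λ d → (a + d) % p) b∸a≡kp ⟩
    (a + k * p) % p     ≡⟨ [m+kn]%n≡m%n a k p ⟩
    a % p               ∎
    where open ≡-Reasoning

  ModEq⇒%-≡ : ∀ {a b} → ModEq p a b → a % p ≡ b % p
  ModEq⇒%-≡ {a} {b} (p∣a∸b , p∣b∸a) with ≤-total a b
  ... | inj₁ a≤b = sym (∣∸⇒%-≡ a≤b p∣b∸a)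
  ... | inj₂ b≤a = ∣∸⇒%-≡ b≤a p∣a∸b

  +-congʳ-% : ∀ {a b} c → a % p ≡ b % p → (a + c) % p ≡ (b + c) % p
  +-congʳ-% {a} {b} c a≡b = begin
    (a + c) % p           ≡⟨ %-distribˡ-+ a c p ⟩
    (a % p + c % p) % p   ≡⟨ cong (λ r → (r + c % p) % p) a≡b ⟩
    (b % p + c % p) % p   ≡⟨ %-distribˡ-+ b c p ⟨
    (b + c) % p           ∎
    where open ≡-Reasoning

  -- c is cancelled by adding its additive inverse p ∸ c % p.
  +-cancelʳ-% : ∀ {a b} c → (a + c) % p ≡ (b + c) % p → a % p ≡ b % p
  +-cancelʳ-% {a} {b} c a+c≡b+c = begin
    a % p                ≡⟨ [m+kn]%n≡m%n a m p ⟨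
    (a + m * p) % p      ≡⟨ cong (λ d → (a + d) % p) c+c′≡mp ⟨
    (a + (c + c′)) % p   ≡⟨ %-congˡ (+-assoc a c c′) ⟨
    (a + c + c′) % p     ≡⟨ +-congʳ-% c′ a+c≡b+c ⟩
    (b + c + c′) % p     ≡⟨ %-congˡ (+-assoc b c c′) ⟩
    (b + (c + c′)) % p   ≡⟨ cong (λ d → (b + d) % p) c+c′≡mp ⟩
    (b + m * p) % p      ≡⟨ [m+kn]%n≡m%n b m p ⟩
    b % p                ∎
    where
    open ≡-Reasoning
    c′ = p ∸ c % p
    m = suc (c / p)
    c+c′≡mp : c + c′ ≡ m * p
    c+c′≡mp = begin
      c + c′                        ≡⟨ cong (_+ c′) (m≡m%n+[m/n]*n c p) ⟩
      c % p + c / p * p + c′        ≡⟨ cong (_+ c′) (+-comm (c % p) (c / p * p)) ⟩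
      c / p * p + c % p + c′        ≡⟨ +-assoc (c / p * p) (c % p) c′ ⟩
      c / p * p + (c % p + c′)      ≡⟨ cong (c / p * p +_) (m+[n∸m]≡n (m%n≤n c p)) ⟩
      c / p * p + p                 ≡⟨ +-comm (c / p * p) p ⟩
      m * p                         ∎

  +-cancelˡ-% : ∀ {a b} c → (c + a) % p ≡ (c + b) % p → a % p ≡ b % p
  +-cancelˡ-% {a} {b} c c+a≡c+b =
    +-cancelʳ-% c (subst₂ (λ x y → x % p ≡ y % p) (+-comm c a) (+-comm c b) c+a≡c+b)

  %-≡⇒≡ : ∀ {a b} → a < p → b < p → a % p ≡ b % p → a ≡ b
  %-≡⇒≡ a<p b<p a≡b = trans (sym (m<n⇒m%n≡m a<p)) (trans a≡b (m<n⇒m%n≡m b<p))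

  ModEq-cancelˡ : ∀ k {a b : Fin p} → ModEq p (k + toℕ a) (k + toℕ b) → a ≡ b
  ModEq-cancelˡ k a≡b = toℕ-injective (%-≡⇒≡ (toℕ<n _) (toℕ<n _) (+-cancelˡ-% k (ModEq⇒%-≡ a≡b)))

  ModEq-cancelʳ : ∀ k {a b : Fin p} → ModEq p (toℕ a + k) (toℕ b + k) → a ≡ b
  ModEq-cancelʳ k a≡b = toℕ-injective (%-≡⇒≡ (toℕ<n _) (toℕ<n _) (+-cancelʳ-% k (ModEq⇒%-≡ a≡b)))

  module _ (p-prime : Prime p) where

    private
      0<a<p⇒p∤a : ∀ {a} → 0 < a → a < p → ¬ p ∣ a
      0<a<p⇒p∤a 0<a a<p = >⇒∤ {{>-nonZero 0<a}} a<p

      *-cancelˡ-<-% : ∀ {m a b} → 0 < m → m < p → a < b → b < p → (m * a) % p ≢ (m * b) % p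
      *-cancelˡ-<-% {m} {a} {b} 0<m m<p a<b b<p ma≡mb
        with euclidsLemma m (b ∸ a) p-prime (m%n≡0⇒n∣m _ p m[b∸a]≡0)
        where
        m[b∸a]≡0 : (m * (b ∸ a)) % p ≡ 0
        m[b∸a]≡0 = begin
          (m * (b ∸ a)) % p          ≡⟨ +-cancelˡ-% (m * a) (begin
            (m * a + m * (b ∸ a)) % p  ≡⟨ %-congˡ (*-distribˡ-+ m a (b ∸ a)) ⟨
            (m * (a + (b ∸ a))) % p    ≡⟨ %-congˡ (cong (m *_) (m+[n∸m]≡n (<⇒≤ a<b))) ⟩
            (m * b) % p                ≡⟨ ma≡mb ⟨
            (m * a) % p                ≡⟨ %-congˡ (+-identityʳ (m * a)) ⟨
            (m * a + 0) % p            ∎) ⟩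
          0 % p                      ≡⟨ m<n⇒m%n≡m (>-nonZero⁻¹ p) ⟩
          0                          ∎
          where open ≡-Reasoning
      ... | inj₁ p∣m   = 0<a<p⇒p∤a 0<m m<p p∣m
      ... | inj₂ p∣b∸a = 0<a<p⇒p∤a (m<n⇒0<n∸m a<b) (≤-<-trans (m∸n≤m b a) b<p) p∣b∸a

    *-cancelˡ-% : ∀ {m a b} → 0 < m → m < p → a < p → b < p → (m * a) % p ≡ (m * b) % p → a ≡ b
    *-cancelˡ-% {m} {a} {b} 0<m m<p a<p b<p ma≡mb with <-cmp a b
    ... | tri< a<b _ _ = ⊥-elim (*-cancelˡ-<-% 0<m m<p a<b b<p ma≡mb)
    ... | tri≈ _ a≡b _ = a≡b
    ... | tri> _ _ b<a = ⊥-elim (*-cancelˡ-<-% 0<m m<p b<a a<p (sym ma≡mb))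

    private
      walk-step : ∀ {z z′ z₀ a b} k → (z + a) % p ≡ (b + z′) % p →
        (z + k * b) % p ≡ (z₀ + k * a) % p → (z′ + suc k * b) % p ≡ (z₀ + suc k * a) % p
      walk-step {z} {z′} {z₀} {a} {b} k z+a≡b+z′ invariant = begin
        (z′ + (b + k * b)) % p   ≡⟨ %-congˡ (reassoc₁ z′ b k) ⟩
        (b + z′ + k * b) % p     ≡⟨ +-congʳ-% (k * b) z+a≡b+z′ ⟨
        (z + a + k * b) % p      ≡⟨ %-congˡ (reassoc₂ z a k b) ⟩
        (z + k * b + a) % p      ≡⟨ +-congʳ-% a invariant ⟩
        (z₀ + k * a + a) % p     ≡⟨ %-congˡ (reassoc₃ z₀ k a) ⟩
        (z₀ + (a + k * a)) % p   ∎
        where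
        open ≡-Reasoning
        reassoc₁ : ∀ z′ b k → z′ + (b + k * b) ≡ b + z′ + k * b
        reassoc₁ = solve-∀
        reassoc₂ : ∀ z a k b → z + a + k * b ≡ z + k * b + a
        reassoc₂ = solve-∀
        reassoc₃ : ∀ z₀ k a → z₀ + k * a + a ≡ z₀ + (a + k * a)
        reassoc₃ = solve-∀

      walk-separates : ∀ {z z₀ a b k l} → a < p → b < p → a ≢ b → k < l → l < p →
        (z + k * b) % p ≡ (z₀ + k * a) % p → (z + l * b) % p ≢ (z₀ + l * a) % p
      walk-separates {z} {z₀} {a} {b} {k} {l} a<p b<p a≢b k<l l<p invariantₖ invariantₗ =
        a≢b (*-cancelˡ-% (m<n⇒0<n∸m k<l) (≤-<-trans (m∸n≤m l k) l<p) a<p b<p (sym (+-cancelˡ-% (z + k * b) (begin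
          (z + k * b + m * b) % p    ≡⟨ %-congˡ (split z b) ⟨
          (z + l * b) % p            ≡⟨ invariantₗ ⟩
          (z₀ + l * a) % p           ≡⟨ %-congˡ (split z₀ a) ⟩
          (z₀ + k * a + m * a) % p   ≡⟨ +-congʳ-% (m * a) invariantₖ ⟨
          (z + k * b + m * a) % p    ∎))))
        where
        open ≡-Reasoning
        m = l ∸ k
        split : ∀ z b → z + l * b ≡ z + k * b + m * b
        split z b = begin
          z + l * b             ≡⟨ cong (λ l → z + l * b) (m+[n∸m]≡n (<⇒≤ k<l)) ⟨
          z + (k + m) * b       ≡⟨ distribute z k m b ⟩
          z + k * b + m * b     ∎
          where
          distribute : ∀ z k m b → z + (k + m) * b ≡ z + k * b + m * b
          distribute = solve-∀

    -- Walking from z₀ in steps of u₁ − u₂ ≢ 0 visits p distinct points, as p is prime.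
    translation-invariant⇒full : (P : Fin p → Set) {u₁ u₂ : Fin p} → u₁ ≢ u₂ →
      (∀ {z} → P z → ∃ λ z′ → P z′ × (toℕ z + toℕ u₁) % p ≡ (toℕ u₂ + toℕ z′) % p) →
      ∀ {z₀} → P z₀ → ∀ z → P z
    translation-invariant⇒full P {u₁} {u₂} u₁≢u₂ step {z₀} Pz₀ z =
      subst P (proj₂ visit) (proj₁ (proj₂ (walk (toℕ (proj₁ visit)))))
      where
      Walk : ℕ → Set
      Walk k = ∃ λ z → P z × (toℕ z + k * toℕ u₂) % p ≡ (toℕ z₀ + k * toℕ u₁) % p
      walk : ∀ k → Walk k
      walk zero = z₀ , Pz₀ , refl
      walk (suc k) with z , Pz , invariant ← walk k
        with z′ , Pz′ , z+u₁≡u₂+z′ ← step Pz = z′ , Pz′ , walk-step k z+u₁≡u₂+z′ invariant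
      position : Fin p → Fin p
      position k = proj₁ (walk (toℕ k))
      separated : ∀ k l → toℕ k < toℕ l → position k ≢ position l
      separated k l k<l eq = walk-separates (toℕ<n u₁) (toℕ<n u₂) (u₁≢u₂ ∘ toℕ-injective) k<l (toℕ<n l)
        (proj₂ (proj₂ (walk (toℕ k))))
        (subst (λ w → (toℕ w + toℕ l * toℕ u₂) % p ≡ (toℕ z₀ + toℕ l * toℕ u₁) % p) (sym eq)
          (proj₂ (proj₂ (walk (toℕ l)))))
      position-injective : Injective _≡_ _≡_ position
      position-injective {k} {l} eq with <-cmp (toℕ k) (toℕ l)
      ... | tri< k<l _ _ = ⊥-elim (separated k l k<l eq)
      ... | tri≈ _ k≡l _ = toℕ-injective k≡l
      ... | tri> _ _ l<k = ⊥-elim (separated l k l<k (sym eq))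
      visit : ∃ λ k → position k ≡ z
      visit = injective⇒surjective position position-injective z

module Configuration {n r} (C : CoherentConfiguration n r) where
  open CoherentConfiguration C public

  SameFiber : Fin n → Fin n → Set
  SameFiber α β = col α α ≡ col β β

  neighbour? : Fin n → Fin r → Fin n → Bool
  neighbour? α s β = ⌊ col α β ≟ s ⌋

  Midpoint : Fin r → Fin r → Fin n → Fin n → Fin n → Set
  Midpoint s t α β γ = col α γ ≡ s × col γ β ≡ t

  opaque
    neighbours⇒≤count : ∀ {k α s} (f : Fin k → Fin n) → Injective _≡_ _≡_ f →
      (∀ i → col α (f i) ≡ s) → k ≤ count (neighbour? α s)
    neighbours⇒≤count f f-injective f-neighbour = injection⇒≤count _ f f-injective (fromWitness ∘ f-neighbour)

    ≤count⇒neighbours : ∀ {k α s} → k ≤ count (neighbour? α s) →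
      Σ (Fin k → Fin n) λ f → Injective _≡_ _≡_ f × (∀ i → col α (f i) ≡ s)
    ≤count⇒neighbours k≤count with f , f-injective , f-neighbour ← ≤count⇒injection _ k≤count =
      f , f-injective , toWitness ∘ f-neighbour

    midpoints⇒≤paths : ∀ {k s t α β} (f : Fin k → Fin n) → Injective _≡_ _≡_ f →
      (∀ i → Midpoint s t α β (f i)) → k ≤ paths s t α β
    midpoints⇒≤paths {s = s} {α = α} f f-injective f-midpoint = injection⇒≤count _ f f-injective λ i →
      Equivalence.from (T-∧ {⌊ col α (f i) ≟ s ⌋})
        (fromWitness (proj₁ (f-midpoint i)) , fromWitness (proj₂ (f-midpoint i)))

    ≤paths⇒midpoints : ∀ {k s t α β} → k ≤ paths s t α β →
      Σ (Fin k → Fin n) λ f → Injective _≡_ _≡_ f × (∀ i → Midpoint s t α β (f i))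
    ≤paths⇒midpoints {s = s} {α = α} k≤paths with f , f-injective , f-path ← ≤count⇒injection _ k≤paths =
      f , f-injective , λ i → let αγ∈s , γβ∈t = Equivalence.to (T-∧ {⌊ col α (f i) ≟ s ⌋}) (f-path i)
                              in toWitness αγ∈s , toWitness γβ∈t

    path⇒paths>0 : ∀ {s t α β γ} → Midpoint s t α β γ → 0 < paths s t α β
    path⇒paths>0 {γ = γ} midpoint = midpoints⇒≤paths (λ _ → γ) (λ { {fzero} {fzero} _ → refl }) (λ _ → midpoint)

    paths>0⇒path : ∀ {s t α β} → 0 < paths s t α β → ∃ (Midpoint s t α β)
    paths>0⇒path 0<paths with f , _ , f-midpoint ← ≤paths⇒midpoints 0<paths = f fzero , f-midpoint fzero

    transport-path : ∀ {s t α β γ α′ β′} → col α γ ≡ s → col γ β ≡ t → col α′ β′ ≡ col α β →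
      ∃ (Midpoint s t α′ β′)
    transport-path {s} {t} {α} {β} {γ} {α′} {β′} αγ∈s γβ∈t α′β′∼αβ =
      paths>0⇒path (subst (0 <_) (coherent s t α β α′ β′ (sym α′β′∼αβ)) (path⇒paths>0 (αγ∈s , γβ∈t)))

    source-fiber : ∀ {α β α′ β′} → col α β ≡ col α′ β′ → SameFiber α α′
    source-fiber {α} {β} {α′} {β′} αβ∼α′β′
      with γ , αγ∈1 , _ ← transport-path {γ = α′} refl refl αβ∼α′β′ =
      subst (λ γ → col α γ ≡ col α′ α′) (sym (diagonal α′ α γ (sym αγ∈1))) αγ∈1

    target-fiber : ∀ {α β α′ β′} → col α β ≡ col α′ β′ → SameFiber β β′
    target-fiber {α} {β} {α′} {β′} αβ∼α′β′ = source-fiber (converse α β α′ β′ αβ∼α′β′)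

    SameFiber-invariant : ∀ {α β α′ β′} → col α β ≡ col α′ β′ → SameFiber α β → SameFiber α′ β′
    SameFiber-invariant αβ∼α′β′ α∼β = trans (sym (source-fiber αβ∼α′β′)) (trans α∼β (target-fiber αβ∼α′β′))

    relation-at-every-point : ∀ {α α′} β → SameFiber α α′ → ∃ λ β′ → col α′ β′ ≡ col α β
    relation-at-every-point {α} {α′} β α∼α′
      with β′ , α′β′∈s , _ ← transport-path {γ = β} refl refl (sym α∼α′) = β′ , α′β′∈s

  Difunctional : Fin r → Set
  Difunctional s = ∀ {α δ γ β} → col α δ ≡ s → col γ δ ≡ s → col γ β ≡ s → col α β ≡ s

  Difunctional? : ∀ s → Dec (Difunctional s)
  Difunctional? s = map′ (λ d {α} {δ} {γ} {β} → d α δ γ β) (λ d α δ γ β → d)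
    (all? λ α → all? λ δ → all? λ γ → all? λ β →
      col α δ ≟ s →-dec col γ δ ≟ s →-dec col γ β ≟ s →-dec col α β ≟ s)

  converse-difunctional : ∀ {α β} → Difunctional (col α β) → Difunctional (col β α)
  converse-difunctional {α} {β} d αδ∈s γδ∈s γβ∈s =
    converse _ _ _ _ (d (converse _ _ _ _ γβ∈s) (converse _ _ _ _ γδ∈s) (converse _ _ _ _ αδ∈s))

  Regular⇒Difunctional : ∀ s → Regular s → Difunctional s
  Regular⇒Difunctional s regular {α} {δ} {γ} {β} αδ∈s γδ∈s γβ∈s =
    Equivalence.to (regular (col α β))
      ( col α γ , s
      , (s , col δ γ , refl , (λ _ _ e → converse _ _ γ δ (trans e (sym γδ∈s)))
        , α , γ , refl , path⇒paths>0 (αδ∈s , refl))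
      , refl , α , β , refl , path⇒paths>0 (refl , γβ∈s))

  Difunctional⇒Regular : ∀ s → Difunctional s → Regular s
  Difunctional⇒Regular s d u = mk⇔ to from
    where
    to : ((｛ s ｝ ⊙ star s) ⊙ ｛ s ｝) u → u ≡ s
    to (_ , _ , (t₁ , t₂ , refl , t₂∈s* , α′ , β′ , α′β′∈v , 0<paths′) , refl , α , β , αβ∈u , 0<paths)
      with γ , αγ∈v , γβ∈s ← paths>0⇒path 0<paths
      with δ , αδ∈s , δγ∈s* ← paths>0⇒path (subst (0 <_) (coherent _ _ α′ β′ α γ (trans α′β′∈v (sym αγ∈v))) 0<paths′)
      with α₀ , β₀ , α₀β₀∈s ← surj s =
      trans (sym αβ∈u) (d αδ∈s (trans (converse _ _ β₀ α₀ (trans δγ∈s* (sym (t₂∈s* α₀ β₀ α₀β₀∈s)))) α₀β₀∈s) γβ∈s)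
    from : u ≡ s → ((｛ s ｝ ⊙ star s) ⊙ ｛ s ｝) u
    from refl with α₀ , β₀ , α₀β₀∈s ← surj s =
      col α₀ α₀ , s
      , (s , col β₀ α₀ , refl , (λ _ _ e → converse _ _ α₀ β₀ (trans e (sym α₀β₀∈s)))
        , α₀ , α₀ , refl , path⇒paths>0 (α₀β₀∈s , refl))
      , refl , α₀ , β₀ , α₀β₀∈s , path⇒paths>0 (refl , α₀β₀∈s)

module WreathFibres (q : ℕ) {n r} (C : CoherentConfiguration n r)
                    (W : ∀ α → FiberIsWreath C (suc (suc q)) α) where
  open Configuration C

  p : ℕ
  p = suc (suc q)

  another : Fin p → Fin p
  another fzero    = fsuc fzero
  another (fsuc _) = fzero

  another-≢ : ∀ x → another x ≢ x
  another-≢ fzero    ()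
  another-≢ (fsuc _) ()

  -- The relation of (β, β′) is thin; in coordinates, β and β′ share their second coordinate.
  SameBlock : Fin n → Fin n → Set
  SameBlock β β′ = SameFiber β β′ × (∀ β″ → col β β″ ≡ col β β′ → β″ ≡ β′)

  SameBlock? : ∀ β β′ → Dec (SameBlock β β′)
  SameBlock? β β′ = col β β ≟ col β′ β′ ×-dec all? (λ β″ → col β β″ ≟ col β β′ →-dec β″ ≟ β′)

  module Coordinates (o : Fin n) where
    g : Fin p × Fin p → Fin n
    g = proj₁ (W o)

    g-injective : Injective _≡_ _≡_ g
    g-injective = proj₁ (proj₂ (W o)) _ _

    g-fiber : ∀ X → SameFiber (g X) o
    g-fiber = proj₁ (proj₂ (proj₂ (W o)))

    g-onto : ∀ {β} → SameFiber β o → ∃ λ X → g X ≡ β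
    g-onto = proj₁ (proj₂ (proj₂ (proj₂ (W o)))) _

    g-reflects : ∀ {X Y X′ Y′} → col (g X) (g Y) ≡ col (g X′) (g Y′) → WreathSame p X Y X′ Y′
    g-reflects = Equivalence.to (proj₂ (proj₂ (proj₂ (proj₂ (W o)))) _ _ _ _)

    g-preserves : ∀ {X Y X′ Y′} → WreathSame p X Y X′ Y′ → col (g X) (g Y) ≡ col (g X′) (g Y′)
    g-preserves = Equivalence.from (proj₂ (proj₂ (proj₂ (proj₂ (W o)))) _ _ _ _)

    other-row : ∀ {α x y x′ y′} x″ → g (x , y) ≡ α → y ≢ y′ → col α (g (x″ , y′)) ≡ col α (g (x′ , y′))
    other-row {y = y} {y′ = y′} _ refl y≢y′ = g-preserves (inj₂ (y≢y′ , ModEq-refl p (toℕ y′ + toℕ y)))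

    sameBlock⇒same-row : ∀ {β β′ x y x′ y′} → g (x , y) ≡ β → g (x′ , y′) ≡ β′ → SameBlock β β′ → y ≡ y′
    sameBlock⇒same-row {y = y} {x′} {y′} β≡ refl (_ , thin) with y ≟ y′
    ... | yes y≡y′ = y≡y′
    ... | no  y≢y′ = ⊥-elim (another-≢ x′ (cong proj₁ (g-injective (thin _ (other-row (another x′) β≡ y≢y′)))))

    same-row⇒sameBlock : ∀ {β β′ x y x′ y′} → g (x , y) ≡ β → g (x′ , y′) ≡ β′ → y ≡ y′ → SameBlock β β′
    same-row⇒sameBlock {x = x} {y} {x′} refl refl refl = trans (g-fiber _) (sym (g-fiber _)) , thin
      where
      thin : ∀ β″ → col (g (x , y)) β″ ≡ col (g (x , y)) (g (x′ , y)) → β″ ≡ g (x′ , y)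
      thin β″ related with (x″ , y″) , refl ← g-onto (trans (target-fiber related) (g-fiber _))
        with g-reflects related
      ... | inj₁ (refl , _ , x″≡x′) = cong (λ x → g (x , y)) (ModEq-cancelʳ (toℕ x) x″≡x′)
      ... | inj₂ (y≢y″ , y″≡y) = ⊥-elim (y≢y″ (sym (ModEq-cancelʳ (toℕ y) y″≡y)))

    translation : ∀ {z′ y′ z y u₁ u₂ v} → col (g (z′ , y′)) (g (z , y)) ≡ col (g (u₁ , v)) (g (u₂ , v)) →
      y′ ≡ y × ModEq p (toℕ z + toℕ u₁) (toℕ u₂ + toℕ z′)
    translation {y′ = y′} {y = y} {v = v} related with g-reflects related
    ... | inj₁ (y′≡y , _ , shift) = y′≡y , shift
    ... | inj₂ (y′≢y , y+v≡v+y′) =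
      ⊥-elim (y′≢y (sym (ModEq-cancelʳ (toℕ v) (subst (ModEq p _) (+-comm (toℕ v) (toℕ y′)) y+v≡v+y′))))

    coordinates-difunctional : ∀ {A D G B} → col (g A) (g D) ≡ col (g G) (g D) →
      col (g G) (g B) ≡ col (g G) (g D) → col (g A) (g B) ≡ col (g A) (g D)
    coordinates-difunctional {xa , ya} {xd , yd} {xc , yc} {xb , yb} AD∼GD GB∼GD with g-reflects AD∼GD
    ... | inj₁ (refl , refl , xc≡xa) rewrite ModEq-cancelˡ (toℕ xd) xc≡xa = GB∼GD
    ... | inj₂ (ya≢yd , yc≡ya) with refl ← ModEq-cancelˡ (toℕ yd) {yc} {ya} yc≡ya | g-reflects GB∼GD
    ...   | inj₁ (refl , yc≡yd , _) = ⊥-elim (ya≢yd yc≡yd)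
    ...   | inj₂ (_ , yb≡yd) with refl ← ModEq-cancelʳ (toℕ yc) {yb} {yd} yb≡yd = other-row xb refl ya≢yd

  sameFiber⇒difunctional : ∀ {a b} → SameFiber a b → Difunctional (col a b)
  sameFiber⇒difunctional {a} {b} a∼b {α} {δ} {γ} {β} αδ∈s γδ∈s γβ∈s
    with A , refl ← Coordinates.g-onto a (source-fiber αδ∈s)
       | D , refl ← Coordinates.g-onto a (trans (target-fiber αδ∈s) (sym a∼b))
       | G , refl ← Coordinates.g-onto a (source-fiber γδ∈s)
       | B , refl ← Coordinates.g-onto a (trans (target-fiber γβ∈s) (sym a∼b)) =
    trans (Coordinates.coordinates-difunctional a (trans αδ∈s (sym γδ∈s)) (trans γβ∈s (sym γδ∈s))) αδ∈s

  SameBlock-sym : ∀ {β β′} → SameBlock β β′ → SameBlock β′ β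
  SameBlock-sym {β} β∼β′
    with (x , y) , β≡ ← Coordinates.g-onto β refl
       | (x′ , y′) , refl ← Coordinates.g-onto β (sym (proj₁ β∼β′)) =
    Coordinates.same-row⇒sameBlock β refl β≡ (sym (Coordinates.sameBlock⇒same-row β β≡ refl β∼β′))

  outside-block : ∀ {a b b′} → SameFiber a b → ¬ SameBlock a b → SameBlock b b′ → col a b′ ≡ col a b
  outside-block {a} {b} a∼b a≁b b∼b′
    with (xa , ya) , a≡ ← Coordinates.g-onto a refl
       | (xb , yb) , refl ← Coordinates.g-onto a (sym a∼b)
       | (xb′ , yb′) , refl ← Coordinates.g-onto a (trans (sym (proj₁ b∼b′)) (sym a∼b))
    with refl ← Coordinates.sameBlock⇒same-row a refl refl b∼b′ =
    Coordinates.other-row a xb′ a≡ (λ { refl → a≁b (Coordinates.same-row⇒sameBlock a a≡ refl refl) })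

  blockPoint : Fin n → Fin p → Fin n
  blockPoint b k = Coordinates.g b (k , proj₂ (proj₁ (Coordinates.g-onto b refl)))

  blockPoint-injective : ∀ b → Injective _≡_ _≡_ (blockPoint b)
  blockPoint-injective b eq = cong proj₁ (Coordinates.g-injective b eq)

  blockPoint-sameBlock : ∀ b k → SameBlock b (blockPoint b k)
  blockPoint-sameBlock b k = Coordinates.same-row⇒sameBlock b (proj₂ (Coordinates.g-onto b refl)) refl refl

  blockPoints-sameBlock : ∀ b k k′ → SameBlock (blockPoint b k) (blockPoint b k′)
  blockPoints-sameBlock b k k′ = Coordinates.same-row⇒sameBlock b refl refl refl

  blockPoint-onto : ∀ {b b′} → SameBlock b b′ → ∃ λ k → blockPoint b k ≡ b′
  blockPoint-onto {b} b∼b′ with (x′ , y′) , refl ← Coordinates.g-onto b (sym (proj₁ b∼b′))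
    with refl ← Coordinates.sameBlock⇒same-row b (proj₂ (Coordinates.g-onto b refl)) refl b∼b′ = x′ , refl

  blockIndex : ∀ {b b′} → SameBlock b b′ → Fin p
  blockIndex b∼b′ = proj₁ (blockPoint-onto b∼b′)

  blockIndex-injective : ∀ {b β β′} (b∼β : SameBlock b β) (b∼β′ : SameBlock b β′) →
    blockIndex b∼β ≡ blockIndex b∼β′ → β ≡ β′
  blockIndex-injective {b} b∼β b∼β′ eq =
    trans (sym (proj₂ (blockPoint-onto b∼β))) (trans (cong (blockPoint b) eq) (proj₂ (blockPoint-onto b∼β′)))

  block-filled : ∀ {b b′} (e : Fin p → Fin n) → Injective _≡_ _≡_ e →
    (∀ i → SameBlock b (e i)) → SameBlock b b′ → ∃ λ i → e i ≡ b′
  block-filled e e-injective b∼e b∼b′ =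
    proj₁ hit , blockIndex-injective (b∼e _) b∼b′ (proj₂ hit)
    where
    index-injective : Injective _≡_ _≡_ (λ i → blockIndex (b∼e i))
    index-injective eq = e-injective (blockIndex-injective (b∼e _) (b∼e _) eq)
    hit : ∃ λ i → blockIndex (b∼e i) ≡ blockIndex b∼b′
    hit = injective⇒surjective _ index-injective (blockIndex b∼b′)

  block-pigeonhole : ∀ {b} (f : Fin (suc p) → Fin n) → (∀ i → SameBlock b (f i)) →
    ∃₂ λ i j → i Fin.< j × f i ≡ f j
  block-pigeonhole f b∼f with i , j , i<j , eq ← pigeonhole (n<1+n p) (λ i → blockIndex (b∼f i)) =
    i , j , i<j , blockIndex-injective (b∼f i) (b∼f j) eq

  transversal-meets-every-block : ∀ {b} (e : Fin p → Fin n) → (∀ i → SameFiber (e i) b) →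
    (∀ {i j} → SameBlock (e i) (e j) → i ≡ j) → ∃ λ i → SameBlock b (e i)
  transversal-meets-every-block {b} e e∼b e-transversal =
    proj₁ hit , same-row⇒sameBlock (proj₂ base) (proj₂ (coords _)) (sym (proj₂ hit))
    where
    open Coordinates b
    base : ∃ λ X → g X ≡ b
    base = g-onto refl
    coords : ∀ i → ∃ λ X → g X ≡ e i
    coords i = g-onto (e∼b i)
    row : Fin p → Fin p
    row i = proj₂ (proj₁ (coords i))
    row-injective : Injective _≡_ _≡_ row
    row-injective {i} {j} eq =
      e-transversal (same-row⇒sameBlock (proj₂ (coords i)) (proj₂ (coords j)) eq)
    hit : ∃ λ i → row i ≡ proj₂ (proj₁ base)
    hit = injective⇒surjective row row-injective (proj₂ (proj₁ base))

  another-block : ∀ c → ∃ λ b → SameFiber c b × ¬ SameBlock c b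
  another-block c with (x , y) , c≡ ← Coordinates.g-onto c refl =
    Coordinates.g c (x , another y) , sym (Coordinates.g-fiber c _) ,
    λ c∼b → another-≢ y (sym (Coordinates.sameBlock⇒same-row c c≡ refl c∼b))

  blockRepresentative : Fin n → Fin p → Fin n
  blockRepresentative a y = Coordinates.g a (fzero , y)

  blockRepresentative-fiber : ∀ a y → SameFiber (blockRepresentative a y) a
  blockRepresentative-fiber a y = Coordinates.g-fiber a _

  blockRepresentative-transversal : ∀ a {y y′} → SameBlock (blockRepresentative a y) (blockRepresentative a y′) → y ≡ y′
  blockRepresentative-transversal a = Coordinates.sameBlock⇒same-row a refl refl

module OffDiagonal (q : ℕ) (p-prime : Prime (suc (suc q))) {n r} (C : CoherentConfiguration n r)
                   (W : ∀ α → FiberIsWreath C (suc (suc q)) α)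
                   (V : CoherentConfiguration.ValencyOffDiag C (suc (suc q))) where
  open Configuration C
  open WreathFibres q C W

  p-neighbours : ∀ {x y} → ¬ SameFiber x y →
    Σ (Fin p → Fin n) λ e → Injective _≡_ _≡_ e × (∀ i → col x (e i) ≡ col x y)
  p-neighbours x≁y = ≤count⇒neighbours (≤-reflexive (sym (V _ _ x≁y)))

  neighbours-≤p : ∀ {x y k} → ¬ SameFiber x y → (f : Fin k → Fin n) → Injective _≡_ _≡_ f →
    (∀ i → col x (f i) ≡ col x y) → k ≤ p
  neighbours-≤p x≁y f f-injective f-neighbour = subst (_ ≤_) (V _ _ x≁y) (neighbours⇒≤count f f-injective f-neighbour)

  block⊆neighbourhood⇒neighbourhood⊆block : ∀ {x y b β} → ¬ SameFiber x y →
    (∀ b′ → SameBlock b b′ → col x b′ ≡ col x y) → col x β ≡ col x y → SameBlock b β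
  block⊆neighbourhood⇒neighbourhood⊆block {x} {y} {b} {β} x≁y block⊆ xβ∈s with SameBlock? b β
  ... | yes b∼β = b∼β
  ... | no  b≁β = ⊥-elim (n≮n p (neighbours-≤p x≁y f f-injective f-neighbour))
    where
    f : Fin (suc p) → Fin n
    f fzero    = β
    f (fsuc k) = blockPoint b k
    β≢blockPoint : ∀ k → β ≢ blockPoint b k
    β≢blockPoint k refl = b≁β (blockPoint-sameBlock b k)
    f-injective : Injective _≡_ _≡_ f
    f-injective {fzero}  {fzero}  _  = refl
    f-injective {fzero}  {fsuc k} eq = ⊥-elim (β≢blockPoint k eq)
    f-injective {fsuc k} {fzero}  eq = ⊥-elim (β≢blockPoint k (sym eq))
    f-injective {fsuc k} {fsuc l} eq = cong fsuc (blockPoint-injective b eq)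
    f-neighbour : ∀ i → col x (f i) ≡ col x y
    f-neighbour fzero    = xβ∈s
    f-neighbour (fsuc k) = block⊆ _ (blockPoint-sameBlock b k)

  difunctional⇒neighbours-in-one-block : ∀ {x y y₁ y₂} → Difunctional (col x y) → ¬ SameFiber x y →
    col x y₁ ≡ col x y → col x y₂ ≡ col x y → SameBlock y₁ y₂
  difunctional⇒neighbours-in-one-block {x} {y} {y₁} {y₂} d x≁y xy₁∈s xy₂∈s with SameBlock? y₁ y₂
  ... | yes y₁∼y₂ = y₁∼y₂
  ... | no  y₁≁y₂ = SameBlock-sym (block⊆neighbourhood⇒neighbourhood⊆block x≁y block⊆ xy₁∈s)
    where
    y₁∼y₂ : SameFiber y₁ y₂
    y₁∼y₂ = target-fiber (trans xy₁∈s (sym xy₂∈s))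
    block⊆ : ∀ b′ → SameBlock y₂ b′ → col x b′ ≡ col x y
    block⊆ b′ y₂∼b′ with γ , y₁γ∼y₁x , γb′∈s ← transport-path {γ = x} refl xy₂∈s (outside-block y₁∼y₂ y₁≁y₂ y₂∼b′) =
      d xy₁∈s (trans (converse _ _ _ _ y₁γ∼y₁x) xy₁∈s) γb′∈s

  difunctional⇒block⊆neighbourhood : ∀ {x y y₁ b′} → Difunctional (col x y) → ¬ SameFiber x y →
    col x y₁ ≡ col x y → SameBlock y₁ b′ → col x b′ ≡ col x y
  difunctional⇒block⊆neighbourhood d x≁y xy₁∈s y₁∼b′
    with e , e-injective , e-neighbour ← p-neighbours x≁y
    with i , refl ← block-filled e e-injective
                      (λ i → difunctional⇒neighbours-in-one-block d x≁y xy₁∈s (e-neighbour i)) y₁∼b′ =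
    e-neighbour i

  module _ {e : Fin n} where
    open Coordinates e

    -- The relation of (e₁, e₂) translates the block of e by u₂ − u₁ ≢ 0, which generates ℤ/p.
    two-in-a-block⇒block-closed : ∀ {x e₁ e₂ a e′} → e₁ ≢ e₂ → SameBlock e₁ e₂ → col x e₁ ≡ col x e₂ →
      col a e ≡ col x e₁ → SameBlock e e′ → col a e′ ≡ col a e
    two-in-a-block⇒block-closed {x} {e₁} {e₂} {a} e₁≢e₂ e₁∼e₂ xe₁∼xe₂ ae∈s e∼e′
      with (z₀ , y) , e≡ ← g-onto refl
         | (u₁ , v) , refl ← g-onto (sym (target-fiber ae∈s))
         | (u₂ , v′) , refl ← g-onto (trans (sym (proj₁ e₁∼e₂)) (sym (target-fiber ae∈s)))
         | (z′ , y′) , refl ← g-onto (sym (proj₁ e∼e′))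
      with refl ← sameBlock⇒same-row refl refl e₁∼e₂
         | refl ← sameBlock⇒same-row e≡ refl e∼e′ =
      translation-invariant⇒full p-prime P {u₁} {u₂} (λ { refl → e₁≢e₂ refl }) step (cong (col a) e≡) z′
      where
      P : Fin p → Set
      P z = col a (g (z , y)) ≡ col a e
      step : ∀ {z} → P z → ∃ λ z′ → P z′ × (toℕ z + toℕ u₁) % p ≡ (toℕ u₂ + toℕ z′) % p
      step {z} Pz with d , ad∈s , dz∼e₁e₂ ← transport-path {γ = g (u₁ , v)} refl refl (trans Pz (trans ae∈s xe₁∼xe₂))
        with (z′ , y′) , refl ← g-onto (trans (source-fiber dz∼e₁e₂) (g-fiber _))
        with refl , shift ← translation dz∼e₁e₂ =
        z′ , trans ad∈s (sym ae∈s) , ModEq⇒%-≡ {a = toℕ z + toℕ u₁} {b = toℕ u₂ + toℕ z′} shift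

  two-in-a-block⇒difunctional : ∀ {x e₁ e₂} → ¬ SameFiber x e₁ → e₁ ≢ e₂ → SameBlock e₁ e₂ →
    col x e₁ ≡ col x e₂ → Difunctional (col x e₁)
  two-in-a-block⇒difunctional x≁e₁ e₁≢e₂ e₁∼e₂ xe₁∼xe₂ {α} {δ} {γ} {β} αδ∈s γδ∈s γβ∈s =
    trans (two-in-a-block⇒block-closed e₁≢e₂ e₁∼e₂ xe₁∼xe₂ αδ∈s δ∼β) αδ∈s
    where
    δ∼β : SameBlock δ β
    δ∼β = block⊆neighbourhood⇒neighbourhood⊆block (x≁e₁ ∘ SameFiber-invariant γδ∈s)
      (λ _ → two-in-a-block⇒block-closed e₁≢e₂ e₁∼e₂ xe₁∼xe₂ γδ∈s) (trans γβ∈s (sym γδ∈s))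

  ¬difunctional⇒neighbours-in-distinct-blocks : ∀ {x y y₁ y₂} → ¬ Difunctional (col x y) → ¬ SameFiber x y →
    col x y₁ ≡ col x y → col x y₂ ≡ col x y → SameBlock y₁ y₂ → y₁ ≡ y₂
  ¬difunctional⇒neighbours-in-distinct-blocks {y₁ = y₁} {y₂} nd x≁y xy₁∈s xy₂∈s y₁∼y₂ with y₁ ≟ y₂
  ... | yes y₁≡y₂ = y₁≡y₂
  ... | no  y₁≢y₂ = ⊥-elim (nd (subst Difunctional xy₁∈s
          (two-in-a-block⇒difunctional (x≁y ∘ SameFiber-invariant xy₁∈s) y₁≢y₂ y₁∼y₂ (trans xy₁∈s (sym xy₂∈s)))))

  ¬difunctional⇒meets-every-block : ∀ {x y b} → ¬ Difunctional (col x y) → ¬ SameFiber x y → SameFiber b y →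
    ∃ λ β → col x β ≡ col x y × SameBlock b β
  ¬difunctional⇒meets-every-block nd x≁y b∼y
    with e , e-injective , e-neighbour ← p-neighbours x≁y
    with i , b∼eᵢ ← transversal-meets-every-block e (λ i → trans (target-fiber (e-neighbour i)) (sym b∼y))
                      (λ eᵢ∼eⱼ → e-injective (¬difunctional⇒neighbours-in-distinct-blocks nd x≁y
                                                  (e-neighbour _) (e-neighbour _) eᵢ∼eⱼ)) =
    e i , e-neighbour i , b∼eᵢ

  difunctional-targetwise : ∀ {a b b′} → ¬ SameFiber a b → SameFiber b b′ →
    Difunctional (col a b) → Difunctional (col a b′)
  difunctional-targetwise {a} {b} {b′} a≁b b∼b′ d = decidable-stable (Difunctional? _) λ nd →
    let β , aβ∼ab′ , b∼β = ¬difunctional⇒meets-every-block nd (a≁b ∘ λ a∼b′ → trans a∼b′ (sym b∼b′)) b∼b′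
    in nd (subst Difunctional (trans (sym (difunctional⇒block⊆neighbourhood d a≁b refl b∼β)) aβ∼ab′) d)

  difunctional-fibrewise : ∀ {a b a′ b′} → ¬ SameFiber a b → SameFiber a a′ → SameFiber b b′ →
    Difunctional (col a b) → Difunctional (col a′ b′)
  difunctional-fibrewise {a} {b} a≁b a∼a′ b∼b′ d with b″ , a′b″∼ab ← relation-at-every-point b a∼a′ =
    difunctional-targetwise (a≁b ∘ SameFiber-invariant a′b″∼ab) (trans (target-fiber a′b″∼ab) b∼b′)
      (subst Difunctional (sym a′b″∼ab) d)

  difunctional-∘ : ∀ {a b c} → ¬ SameFiber a b → ¬ SameFiber b c → ¬ SameFiber a c →
    Difunctional (col a b) → Difunctional (col b c) → Difunctional (col a c)
  difunctional-∘ {a} {b} {c} a≁b b≁c a≁c dab dbc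
    with e , e-injective , e-neighbour ← p-neighbours a≁c
    with b₁ , ab₁∈s , b₁c₁∈u ← transport-path {γ = b} refl refl (e-neighbour fzero)
       | b₂ , ab₂∈s , b₂c₂∈u ← transport-path {γ = b} refl refl (e-neighbour (fsuc fzero)) =
    subst Difunctional (e-neighbour fzero)
      (two-in-a-block⇒difunctional (a≁c ∘ SameFiber-invariant (e-neighbour fzero)) (λ eq → 0≢1 (e-injective eq))
        c₁∼c₂ (trans (e-neighbour fzero) (sym (e-neighbour (fsuc fzero)))))
    where
    0≢1 : fzero ≢ fsuc fzero
    0≢1 ()
    c₂b₂∈u* : col (e (fsuc fzero)) b₂ ≡ col c b
    c₂b₂∈u* = converse _ _ _ _ b₂c₂∈u
    c₂b₁∼c₂b₂ : col (e (fsuc fzero)) b₁ ≡ col (e (fsuc fzero)) b₂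
    c₂b₁∼c₂b₂ = difunctional⇒block⊆neighbourhood (subst Difunctional (sym c₂b₂∈u*) (converse-difunctional dbc))
      (b≁c ∘ sym ∘ SameFiber-invariant c₂b₂∈u*) refl
      (SameBlock-sym (difunctional⇒neighbours-in-one-block dab a≁b ab₁∈s ab₂∈s))
    c₁∼c₂ : SameBlock (e fzero) (e (fsuc fzero))
    c₁∼c₂ = difunctional⇒neighbours-in-one-block (subst Difunctional (sym b₁c₁∈u) dbc) (b≁c ∘ SameFiber-invariant b₁c₁∈u)
      refl (trans (trans (converse _ _ _ _ c₂b₁∼c₂b₂) b₂c₂∈u) (sym b₁c₁∈u))

  -- If γ′ ≢ γ, each point of the block of β is joined to α by two (t, u)-paths, and all these
  -- midpoints are distinct: α would have more than p t-neighbours.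
  common-neighbour-unique : ∀ {α β γ γ′} → ¬ Difunctional (col β γ) → ¬ SameFiber α γ → ¬ SameFiber β γ →
    (∀ β′ → SameBlock β β′ → col α β′ ≡ col α β) → col α γ′ ≡ col α γ → col β γ′ ≡ col β γ → γ′ ≡ γ
  common-neighbour-unique {α} {β} {γ} {γ′} nd α≁γ β≁γ α-constant αγ′∈t βγ′∈u* with γ′ ≟ γ
  ... | yes γ′≡γ = γ′≡γ
  ... | no  γ′≢γ = ⊥-elim (n≮n p (neighbours-≤p α≁γ f f-injective f-neighbour))
    where
    t u : Fin r
    t = col α γ
    u = col γ β
    b : Fin p → Fin n
    b = blockPoint β
    two-paths : ∀ k → 2 ≤ paths t u α (b k)
    two-paths k = subst (2 ≤_) (coherent t u α β α (b k) (sym (α-constant _ (blockPoint-sameBlock β k))))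
      (midpoints⇒≤paths (λ { fzero → γ ; (fsuc _) → γ′ })
        (λ { {fzero} {fzero} _ → refl ; {fzero} {fsuc fzero} eq → ⊥-elim (γ′≢γ (sym eq))
           ; {fsuc fzero} {fzero} eq → ⊥-elim (γ′≢γ eq) ; {fsuc fzero} {fsuc fzero} _ → refl })
        (λ { fzero → refl , refl ; (fsuc _) → αγ′∈t , converse _ _ _ _ βγ′∈u* }))
    midpoint : Fin p → Fin 2 → Fin n
    midpoint k = proj₁ (≤paths⇒midpoints (two-paths k))
    midpoint-injective : ∀ k → Injective _≡_ _≡_ (midpoint k)
    midpoint-injective k = proj₁ (proj₂ (≤paths⇒midpoints (two-paths k)))
    midpoint-path : ∀ k i → Midpoint t u α (b k) (midpoint k i)
    midpoint-path k = proj₂ (proj₂ (≤paths⇒midpoints (two-paths k)))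
    midpoint-determines-block-point : ∀ {k k′ i i′} → midpoint k i ≡ midpoint k′ i′ → k ≡ k′
    midpoint-determines-block-point {k} {k′} {i} {i′} eq = blockPoint-injective β
      (¬difunctional⇒neighbours-in-distinct-blocks (nd ∘ difunctional-u*) (β≁γ ∘ sym ∘ SameFiber-invariant δbₖ∈u)
        refl (trans (subst (λ δ → col δ (b k′) ≡ u) (sym eq) (proj₂ (midpoint-path k′ i′))) (sym δbₖ∈u))
        (blockPoints-sameBlock β k k′))
      where
      δbₖ∈u : col (midpoint k i) (b k) ≡ u
      δbₖ∈u = proj₂ (midpoint-path k i)
      difunctional-u* : Difunctional (col (midpoint k i) (b k)) → Difunctional (col β γ)
      difunctional-u* d = converse-difunctional (subst Difunctional δbₖ∈u d)
    f : Fin (suc p) → Fin n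
    f fzero    = midpoint fzero (fsuc fzero)
    f (fsuc k) = midpoint k fzero
    f-injective : Injective _≡_ _≡_ f
    f-injective {fzero}  {fzero}  _  = refl
    f-injective {fzero}  {fsuc k} eq with refl ← midpoint-determines-block-point eq with () ← midpoint-injective fzero eq
    f-injective {fsuc k} {fzero}  eq with refl ← midpoint-determines-block-point eq with () ← midpoint-injective fzero eq
    f-injective {fsuc k} {fsuc l} eq = cong fsuc (midpoint-determines-block-point eq)
    f-neighbour : ∀ i → col α (f i) ≡ t
    f-neighbour fzero    = proj₁ (midpoint-path fzero (fsuc fzero))
    f-neighbour (fsuc k) = proj₁ (midpoint-path k fzero)

  -- The p block representatives αᵧ of a's fiber and b each have a neighbour of the relevant kind
  -- in a block B missing c, so two of them share one.
  no-mixed-triangle : ∀ {a b c} → ¬ SameFiber a b → ¬ SameFiber a c → ¬ SameFiber b c →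
    Difunctional (col a b) → ¬ Difunctional (col a c) → ¬ Difunctional (col b c) → ⊥
  no-mixed-triangle {a} {b} {c} a≁b a≁c b≁c dab ndac ndbc
    with B , c∼B , c≁B ← another-block c =
    let i , j , i<j , dᵢ≡dⱼ = block-pigeonhole d (λ i → proj₂ (proj₂ (hit i))) in collision i j i<j dᵢ≡dⱼ
    where
    α : Fin p → Fin n
    α = blockRepresentative a
    α≁c : ∀ y → ¬ SameFiber (α y) c
    α≁c y α∼c = a≁c (trans (sym (blockRepresentative-fiber a y)) α∼c)
    meet : ∀ {x} → ¬ Difunctional (col x c) → ¬ SameFiber x c → ∃ λ β → col x β ≡ col x c × SameBlock B β
    meet nd x≁c = ¬difunctional⇒meets-every-block nd x≁c (sym c∼B)
    source : Fin (suc p) → Fin n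
    source fzero    = b
    source (fsuc y) = α y
    source≁c : ∀ i → ¬ SameFiber (source i) c
    source≁c fzero    = b≁c
    source≁c (fsuc y) = α≁c y
    source-nd : ∀ i → ¬ Difunctional (col (source i) c)
    source-nd fzero    = ndbc
    source-nd (fsuc y) = ndac ∘ difunctional-fibrewise (α≁c y) (blockRepresentative-fiber a y) refl
    hit : ∀ i → ∃ λ β → col (source i) β ≡ col (source i) c × SameBlock B β
    hit i = meet (source-nd i) (source≁c i)
    d : Fin (suc p) → Fin n
    d i = proj₁ (hit i)
    B-misses-c : ∀ i → d i ≢ c
    B-misses-c i dᵢ≡c = c≁B (SameBlock-sym (subst (SameBlock B) dᵢ≡c (proj₂ (proj₂ (hit i)))))
    reaches : ∀ i → col (source i) (d i) ≡ col (source i) c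
    reaches i = proj₁ (proj₂ (hit i))
    collision : ∀ i j → i Fin.< j → d i ≡ d j → ⊥
    collision fzero fzero ()
    collision (fsuc _) fzero ()
    collision fzero (fsuc y) _ d₀≡dᵧ = B-misses-c fzero
      (common-neighbour-unique ndbc (α≁c y) b≁c
        (λ _ → difunctional⇒block⊆neighbourhood (difunctional-fibrewise a≁b (sym (blockRepresentative-fiber a y)) refl dab)
                 (a≁b ∘ trans (sym (blockRepresentative-fiber a y))) refl)
        (subst (λ δ → col (α y) δ ≡ col (α y) c) (sym d₀≡dᵧ) (reaches (fsuc y))) (reaches fzero))
    collision (fsuc y) (fsuc y′) y<y′ dᵧ≡dᵧ′ = B-misses-c (fsuc y)
      (common-neighbour-unique (source-nd (fsuc y′)) (α≁c y) (α≁c y′)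
        (λ _ → outside-block (trans (blockRepresentative-fiber a y) (sym (blockRepresentative-fiber a y′)))
                 (λ αᵧ∼αᵧ′ → <⇒≢ y<y′ (cong fsuc (blockRepresentative-transversal a αᵧ∼αᵧ′))))
        (reaches (fsuc y)) (subst (λ δ → col (α y′) δ ≡ col (α y′) c) (sym dᵧ≡dᵧ′) (reaches (fsuc y′))))

  difunctional-shared-source : ∀ {a b c} → ¬ SameFiber a b → ¬ SameFiber a c →
    Difunctional (col a b) → Difunctional (col a c)
  difunctional-shared-source {a} {b} {c} a≁b a≁c dab = decidable-stable (Difunctional? _) λ ndac →
    case-split ndac (col b b ≟ col c c)
    where
    case-split : ¬ Difunctional (col a c) → Dec (SameFiber b c) → ⊥
    case-split ndac (yes b∼c) = ndac (difunctional-targetwise a≁b b∼c dab)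
    case-split ndac (no  b≁c) with Difunctional? (col b c)
    ... | yes dbc  = ndac (difunctional-∘ a≁b b≁c a≁c dab dbc)
    ... | no  ndbc = no-mixed-triangle a≁b a≁c b≁c dab ndac ndbc

  difunctional-everywhere : ∀ {a b c d} → ¬ SameFiber a b → ¬ SameFiber c d →
    Difunctional (col a b) → Difunctional (col c d)
  difunctional-everywhere {a} {b} {c} {d} a≁b c≁d dab with col a a ≟ col c c
  ... | yes a∼c = difunctional-fibrewise a≁d a∼c refl (difunctional-shared-source a≁b a≁d dab)
    where
    a≁d : ¬ SameFiber a d
    a≁d a∼d = c≁d (trans (sym a∼c) a∼d)
  ... | no  a≁c = difunctional-shared-source (a≁c ∘ sym) c≁d
                    (converse-difunctional (difunctional-shared-source a≁b a≁c dab))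

lemma3p5 : (p : ℕ) → Prime p → (n r : ℕ) → (C : CoherentConfiguration n r) →
    (∀ α → FiberIsWreath C p α) →
    CoherentConfiguration.ValencyOffDiag C p →
    (∀ (s : Fin r) → CoherentConfiguration.Regular C s)
    ⊎ (∀ (s : Fin r) → CoherentConfiguration.InSomeSi C s ⊎ ¬ CoherentConfiguration.Regular C s)
lemma3p5 zero          p-prime _ _ _ _ _ = ⊥-elim (¬prime[0] p-prime)
lemma3p5 (suc zero)    p-prime _ _ _ _ _ = ⊥-elim (¬prime[1] p-prime)
lemma3p5 (suc (suc q)) p-prime n r C W V = dichotomy (all? Difunctional?)
  where
  open Configuration C
  open WreathFibres q C W
  open OffDiagonal q p-prime C W V

  dichotomy : Dec (∀ s → Difunctional s) → (∀ s → Regular s) ⊎ (∀ s → InSomeSi s ⊎ ¬ Regular s)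
  dichotomy (yes all-difunctional) = inj₁ λ s → Difunctional⇒Regular s (all-difunctional s)
  dichotomy (no ¬all-difunctional)
    with s₀ , nd₀ ← ¬∀⟶∃¬ r Difunctional Difunctional? ¬all-difunctional
    with c , d , cd∈s₀ ← surj s₀ = inj₂ classify
    where
    c≁d : ¬ SameFiber c d
    c≁d c∼d = nd₀ (subst Difunctional cd∈s₀ (sameFiber⇒difunctional c∼d))
    classify : ∀ s → InSomeSi s ⊎ ¬ Regular s
    classify s with a , b , ab∈s ← surj s | col a a ≟ col b b
    ... | yes a∼b = inj₁ λ α β αβ∈s → SameFiber-invariant (trans ab∈s (sym αβ∈s)) a∼b
    ... | no  a≁b = inj₂ λ regular → nd₀ (subst Difunctional cd∈s₀
                          (difunctional-everywhere a≁b c≁d (subst Difunctional (sym ab∈s) (Regular⇒Difunctional s regular))))
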